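{- For each integer $\ell\geq 3$ there exist a graph $G_\ell$ with $\omega(G_\ell)=\ell$ and a clique partition $\mathcal{X}_\ell$ of $G_\ell$ that can be output by the algorithm \textsc{Greedy Edmonds} on input $G_\ell$, such that \[ \lim_{\ell\to\infty}\frac{\binom{\ell}{2}+1}{2\binom{\ell}{2}}\cdot\frac{\mathsf{OPT}_\ell}{|E(\mathcal{X}_\ell)|}=1, \] where $\mathsf{OPT}_\ell$ is the maximum number of edges in a clique partition of $G_\ell$.
   Context: $\omega(G)$ is the maximum size of a clique of $G$. A clique partition of $G$ is a partition of $V(G)$ into cliques; for a clique partition $\mathcal{X}$, $E(\mathcal{X})$ is the set of edges of $G$ with both ends in the same part, and the number of edges of the clique partition is $|E(\mathcal{X})|$. The algorithm \textsc{Greedy Edmonds} on input $G$: set $\mathcal{X}=\emptyset$; while $G$ has a vertex: if $\omega(G)=2$, compute a maximum matching $\mathcal{M}$ of $G$, add each edge of $\mathcal{M}$ (as a 2-vertex clique) to $\mathcal{X}$, and replace $G$ by $G-V(\mathcal{M})$; otherwise choose any maximum clique $X$ of $G$, add $X$ to $\mathcal{X}$ and replace $G$ by $G-X$. Output $\mathcal{X}$ (different choices of maximum cliques/matchings may give different outputs). -}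

module Defs where

open import Data.Bool using (Bool; true; false; _∧_)
open import Data.Nat using (ℕ; zero; suc; _+_; _*_; _≤_; _<ᵇ_)
open import Data.Nat.Combinatorics using (_C_)
open import Data.Fin using (Fin; toℕ)
open import Data.Fin.Subset using (Subset; _∈_; _∉_; _⊆_; ⊤; ⁅_⁆; _∪_; _─_; ∣_∣; Nonempty; Empty)
open import Data.Vec using (lookup)
open import Data.List using (List; []; _∷_; _++_; length; filterᵇ; map; concatMap; allFin; cartesianProduct)
open import Data.List.Relation.Unary.All using (All)
open import Data.Nat.ListAction using (sum)
open import Data.List.Relation.Unary.Unique.Propositional using (Unique)
open import Data.Product using (Σ; ∃; _×_; _,_; proj₁; proj₂)
open import Relation.Binary.PropositionalEquality using (_≡_; _≢_)
open import Relation.Nullary using (¬_)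
import Data.Rational as ℚ
open ℚ using (ℚ; 0ℚ)
open import Data.Integer using (+_)

record Graph : Set where
  field
    n      : ℕ
    adj    : Fin n → Fin n → Bool
    sym    : ∀ u v → adj u v ≡ adj v u
    irrefl : ∀ v → adj v v ≡ false
open Graph public

module _ (G : Graph) where

  V : Set
  V = Fin (n G)

  IsClique : Subset (n G) → Set
  IsClique X = ∀ u v → u ∈ X → v ∈ X → u ≢ v → adj G u v ≡ true

  CliqueNumberIn : Subset (n G) → ℕ → Set
  CliqueNumberIn R k =
    (Σ (Subset (n G)) λ X → X ⊆ R × IsClique X × ∣ X ∣ ≡ k)
    × (∀ X → X ⊆ R → IsClique X → ∣ X ∣ ≤ k)

  CliqueNumber : ℕ → Set
  CliqueNumber k = CliqueNumberIn ⊤ k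

  IsMaxCliqueIn : Subset (n G) → Subset (n G) → Set
  IsMaxCliqueIn R X =
    X ⊆ R × IsClique X × (∀ Y → Y ⊆ R → IsClique Y → ∣ Y ∣ ≤ ∣ X ∣)

  Matching : Set
  Matching = List (V × V)

  endpoints : Matching → List V
  endpoints = concatMap (λ e → proj₁ e ∷ proj₂ e ∷ [])

  IsMatchingIn : Subset (n G) → Matching → Set
  IsMatchingIn R M =
    All (λ e → adj G (proj₁ e) (proj₂ e) ≡ true
               × proj₁ e ∈ R × proj₂ e ∈ R) M
    × Unique (endpoints M)

  IsMaxMatchingIn : Subset (n G) → Matching → Set
  IsMaxMatchingIn R M =
    IsMatchingIn R M × (∀ M' → IsMatchingIn R M' → length M' ≤ length M)

  matchedVertices : Matching → Subset (n G)
  matchedVertices []             = Data.Fin.Subset.⊥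
  matchedVertices ((u , v) ∷ M) = (⁅ u ⁆ ∪ ⁅ v ⁆) ∪ matchedVertices M

  edgeParts : Matching → List (Subset (n G))
  edgeParts = map (λ e → ⁅ proj₁ e ⁆ ∪ ⁅ proj₂ e ⁆)

  -- GreedyRun R Xs : starting with the current graph G[R] (and empty X),
  -- the algorithm Greedy Edmonds can add exactly the parts Xs
  -- (in this order) before terminating.
  data GreedyRun : Subset (n G) → List (Subset (n G)) → Set where
    stop     : ∀ {R} → Empty R → GreedyRun R []
    matching : ∀ {R M Xs} → Nonempty R → CliqueNumberIn R 2
             → IsMaxMatchingIn R M
             → GreedyRun (R ─ matchedVertices M) Xs
             → GreedyRun R (edgeParts M ++ Xs)
    clique   : ∀ {R X Xs} → Nonempty R → ¬ CliqueNumberIn R 2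
             → IsMaxCliqueIn R X
             → GreedyRun (R ─ X) Xs
             → GreedyRun R (X ∷ Xs)

  GreedyOutput : List (Subset (n G)) → Set
  GreedyOutput Xs = GreedyRun ⊤ Xs

  multiplicity : List (Subset (n G)) → V → ℕ
  multiplicity []       v = 0
  multiplicity (X ∷ Xs) v with lookup X v
  ... | true  = suc (multiplicity Xs v)
  ... | false = multiplicity Xs v

  IsCliquePartition : List (Subset (n G)) → Set
  IsCliquePartition Xs =
    All (λ X → Nonempty X × IsClique X) Xs
    × (∀ v → multiplicity Xs v ≡ 1)

  edgesWithin : Subset (n G) → ℕ
  edgesWithin X =
    length (filterᵇ (λ e → (toℕ (proj₁ e) <ᵇ toℕ (proj₂ e)) ∧ lookup X (proj₁ e)
                          ∧ lookup X (proj₂ e) ∧ adj G (proj₁ e) (proj₂ e))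
                   (cartesianProduct (allFin (n G)) (allFin (n G))))

  numEdges : List (Subset (n G)) → ℕ
  numEdges Xs = sum (map edgesWithin Xs)

  IsOPT : ℕ → Set
  IsOPT k =
    (Σ (List (Subset (n G))) λ Xs → IsCliquePartition Xs × numEdges Xs ≡ k)
    × (∀ Xs → IsCliquePartition Xs → numEdges Xs ≤ k)

-- rationals a / b (with the convention a / 0 = 0, never used below
-- on a zero denominator in a meaningful way)

frac : ℕ → ℕ → ℚ
frac a zero    = 0ℚ
frac a (suc b) = (+ a) ℚ./ suc b

record Instance (ℓ : ℕ) : Set where
  field
    graph     : Graph
    partition : List (Subset (n graph))
    opt       : ℕ
    ω≡ℓ       : CliqueNumber graph ℓ
    greedy    : GreedyOutput graph partition
    isOpt     : IsOPT graph opt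
open Instance public

quantity : ∀ {ℓ} → Instance ℓ → ℚ
quantity {ℓ} I =
  frac ((ℓ C 2) + 1) (2 * (ℓ C 2)) ℚ.* frac (opt I) (numEdges (graph I) (partition I))

-- The graph has m = ℓ! rows and ℓ columns 0, …, ℓ − 1.  Every row is a clique, and column c is
-- moreover cut into blocks of c + 1 consecutive rows, each of which is a clique.  A clique lies in a
-- single row or in a single block, so ω = ℓ, and as no clique has more than ℓ vertices the partition
-- into rows is optimal: OPT = m·C(ℓ,2).  Greedy Edmonds, however, may take the blocks of column
-- ℓ − 1 (maximum cliques), then those of column ℓ − 2, and so on down to column 2; what remains,
-- columns 0 and 1, has ω = 2 and a perfect matching of m edges.  Its output has
-- 2|E| = m(2 + 2 + 3 + ⋯ + (ℓ − 1)) = m(C(ℓ,2) + 1) edges, so the ratio in the theorem is exactly 1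
-- for every ℓ.  Taking m = ℓ! makes every block size divide m.

module Submission where

open import Data.Nat using (ℕ; suc; _≤_; NonZero)
open import Data.Nat.Divisibility using (_∣_)
open import Defs hiding (sym)

module Arithmetic where

  open import Data.Nat using (zero; suc; _+_; _*_; _≤_; _<_; z≤n; s≤s; NonZero)
  open import Data.Nat.Properties
  open import Data.Nat.Combinatorics using (_C_; nCk+nC[k+1]≡[n+1]C[k+1]; nC1≡n)
  open import Data.Nat.DivMod
    using (_/_; _%_; m≡m%n+[m/n]*n; +-distrib-/-∣ʳ; m<n⇒m/n≡0; m*n/n≡m; m/n*n≡m)
  open import Data.Nat.Divisibility using (_∣_; n∣m*n)
  open import Data.Nat.Tactic.RingSolver using (solve-∀)
  open import Relation.Binary.PropositionalEquality

  /%-injective : ∀ a b d .{{_ : NonZero d}} → a / d ≡ b / d → a % d ≡ b % d → a ≡ b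
  /%-injective a b d a/d≡b/d a%d≡b%d = begin
    a                   ≡⟨ m≡m%n+[m/n]*n a d ⟩
    a % d + a / d * d   ≡⟨ cong₂ (λ r q → r + q * d) a%d≡b%d a/d≡b/d ⟩
    b % d + b / d * d   ≡⟨ m≡m%n+[m/n]*n b d ⟨
    b                   ∎
    where open ≡-Reasoning

  [p+b*d]/d≡b : ∀ p b d .{{_ : NonZero d}} → p < d → (p + b * d) / d ≡ b
  [p+b*d]/d≡b p b d p<d = begin
    (p + b * d) / d     ≡⟨ +-distrib-/-∣ʳ p (n∣m*n b) ⟩
    p / d + b * d / d   ≡⟨ cong₂ _+_ (m<n⇒m/n≡0 p<d) (m*n/n≡m b d) ⟩
    b                   ∎
    where open ≡-Reasoning

  p+b*d<m : ∀ {p b d m} .{{_ : NonZero d}} → d ∣ m → p < d → b < m / d → p + b * d < m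
  p+b*d<m {p} {b} {d} {m} d∣m p<d b<m/d = begin-strict
    p + b * d           <⟨ +-monoˡ-< (b * d) p<d ⟩
    d + b * d           ≡⟨⟩
    suc b * d           ≤⟨ *-monoˡ-≤ d b<m/d ⟩
    m / d * d           ≡⟨ m/n*n≡m d∣m ⟩
    m                   ∎
    where open ≤-Reasoning

  suc-C2 : ∀ a → suc a C 2 ≡ a + a C 2
  suc-C2 a = trans (sym (nCk+nC[k+1]≡[n+1]C[k+1] a 1)) (cong (_+ a C 2) (nC1≡n a))

  2*[1+a]C2≡[1+a]*a : ∀ a → 2 * (suc a C 2) ≡ suc a * a
  2*[1+a]C2≡[1+a]*a zero    = refl
  2*[1+a]C2≡[1+a]*a (suc a) = begin
    2 * (suc (suc a) C 2)       ≡⟨ cong (2 *_) (suc-C2 (suc a)) ⟩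
    2 * (suc a + suc a C 2)     ≡⟨ *-distribˡ-+ 2 (suc a) (suc a C 2) ⟩
    2 * suc a + 2 * (suc a C 2) ≡⟨ cong (2 * suc a +_) (2*[1+a]C2≡[1+a]*a a) ⟩
    2 * suc a + suc a * a       ≡⟨ lemma a ⟩
    suc (suc a) * suc a         ∎
    where
    open ≡-Reasoning
    lemma : ∀ a → 2 * suc a + suc a * a ≡ suc (suc a) * suc a
    lemma = solve-∀

  2*[B*C+E]≡m*[C+1] : ∀ B c m E → B * suc c ≡ m → 2 * E ≡ m * (c C 2 + 1) →
                      2 * (B * (suc c C 2) + E) ≡ m * (suc c C 2 + 1)
  2*[B*C+E]≡m*[C+1] B c m E B*[1+c]≡m 2E≡ = begin
    2 * (B * (suc c C 2) + E)          ≡⟨ lemma₁ B (suc c C 2) E ⟩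
    B * (2 * (suc c C 2)) + 2 * E      ≡⟨ cong₂ (λ x y → B * x + y) (2*[1+a]C2≡[1+a]*a c) 2E≡ ⟩
    B * (suc c * c) + m * (c C 2 + 1)  ≡⟨ cong (_+ m * (c C 2 + 1)) (lemma₂ B (suc c) c) ⟩
    B * suc c * c + m * (c C 2 + 1)    ≡⟨ cong (λ x → x * c + m * (c C 2 + 1)) B*[1+c]≡m ⟩
    m * c + m * (c C 2 + 1)            ≡⟨ lemma₃ m c (c C 2) ⟩
    m * (c + c C 2 + 1)                ≡⟨ cong (λ x → m * (x + 1)) (suc-C2 c) ⟨
    m * (suc c C 2 + 1)                ∎
    where
    open ≡-Reasoning
    lemma₁ : ∀ B x E → 2 * (B * x + E) ≡ B * (2 * x) + 2 * E
    lemma₁ = solve-∀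
    lemma₂ : ∀ B d c → B * (d * c) ≡ B * d * c
    lemma₂ = solve-∀
    lemma₃ : ∀ m c x → m * c + m * (x + 1) ≡ m * (c + x + 1)
    lemma₃ = solve-∀

  a≤1+s⇒2*aC2≤a*s : ∀ {a s} → a ≤ suc s → 2 * (a C 2) ≤ a * s
  a≤1+s⇒2*aC2≤a*s {zero}  _       = z≤n
  a≤1+s⇒2*aC2≤a*s {suc a} (s≤s a≤s) =
    ≤-trans (≤-reflexive (2*[1+a]C2≡[1+a]*a a)) (*-monoʳ-≤ (suc a) a≤s)

module Counting where

  open import Data.Bool using (Bool; true; false; _∧_; T)
  open import Data.Nat using (ℕ; zero; suc; _+_; _≤_; _<_; _<ᵇ_; z≤n; s≤s)
  open import Data.Nat.Properties
  open import Data.Nat.Combinatorics using (_C_)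
  open import Data.Nat.DivMod using (_mod_; m<n⇒m%n≡m)
  open import Data.Fin using (Fin; zero; suc; toℕ)
  import Data.Fin.Properties as Finₚ
  open Finₚ using (toℕ-fromℕ<)
  open import Data.Fin.Subset
    using (Subset; inside; outside; _∈_; _∉_; _⊆_; _-_; _─_; _∪_; ⁅_⁆; ⊤; ∣_∣; Empty)
  open import Data.Fin.Subset.Properties
    using ( x∈p⇒∣p-x∣<∣p∣; x∈p∧x≢y⇒x∈p-y; ∈⊤; ⊆⊤; ∣⊤∣≡n; ∣⁅x⁆∣≡1; ∪-identityˡ; ∪-identityʳ
          ; x∈p∪q⁻; x∈⁅y⁆⇒x≡y; p─q⊆p; x∈p∧x∉q⇒x∈p─q; ⊆-antisym)
  import Data.Vec as Vec
  open import Data.Vec using ([]; _∷_; here; there; lookup)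
  open import Data.Vec.Properties using (lookup⇒[]=; []=⇒lookup; lookup∘tabulate; tabulate-cong)
  open import Data.List using (List; []; _∷_; length; map; tabulate; filterᵇ; cartesianProduct; _++_)
  open import Data.List.Properties using (length-map; length-tabulate; filter-++; length-++)
  open import Data.List.Relation.Unary.All as All using (All; []; _∷_)
  open import Data.List.Relation.Unary.All.Properties as All using ()
  open import Data.List.Relation.Unary.AllPairs using ([]; _∷_)
  open import Data.List.Relation.Unary.Unique.Propositional using (Unique)
  import Data.List.Relation.Unary.Unique.Propositional.Properties as Unique
  open import Data.Product using (_×_; _,_)
  open import Data.Sum using (inj₁; inj₂)
  open import Data.Empty using (⊥-elim)
  open import Function using (_∘_; _⇔_)
  open import Relation.Nullary using (Dec; yes; no; does; T?)
  open import Relation.Nullary.Decidable using (dec-true; does-⇔; _×-dec_; ¬?)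
  open import Relation.Unary using (Decidable)
  open import Relation.Binary.PropositionalEquality
  open import Algebra.Properties.CommutativeMonoid.Sum +-0-commutativeMonoid
    using (sum-replicate-zero) renaming (sum to ∑)

  open Arithmetic

  private
    variable
      A B : Set

  Unique-map⁺ : ∀ {P : A → Set} {f : A → B} {xs} →
                (∀ {x y} → P x → P y → f x ≡ f y → x ≡ y) →
                All P xs → Unique xs → Unique (map f xs)
  Unique-map⁺ inj []         []        = []
  Unique-map⁺ inj (px ∷ pxs) (x∉ ∷ xs!) =
    All.map⁺ (All.zipWith (λ (py , x≢y) → x≢y ∘ inj px py) (pxs , x∉)) ∷ Unique-map⁺ inj pxs xs!

  elements : ∀ {n} → Subset n → List (Fin n)
  elements []            = []
  elements (inside ∷ p)  = zero ∷ map suc (elements p)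
  elements (outside ∷ p) = map suc (elements p)

  length-elements : ∀ {n} (p : Subset n) → length (elements p) ≡ ∣ p ∣
  length-elements []            = refl
  length-elements (inside ∷ p)  = cong suc (trans (length-map suc (elements p)) (length-elements p))
  length-elements (outside ∷ p) = trans (length-map suc (elements p)) (length-elements p)

  elements-unique : ∀ {n} (p : Subset n) → Unique (elements p)
  elements-unique []            = []
  elements-unique (inside ∷ p)  =
    All.map⁺ (All.universal (λ _ ()) (elements p)) ∷ Unique.map⁺ Finₚ.suc-injective (elements-unique p)
  elements-unique (outside ∷ p) = Unique.map⁺ Finₚ.suc-injective (elements-unique p)

  elements-⊆ : ∀ {n} (p : Subset n) → All (_∈ p) (elements p)
  elements-⊆ []            = []
  elements-⊆ (inside ∷ p)  = here ∷ All.map⁺ (All.map there (elements-⊆ p))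
  elements-⊆ (outside ∷ p) = All.map⁺ (All.map there (elements-⊆ p))

  length≤∣∣ : ∀ {n} {p : Subset n} {xs} → Unique xs → All (_∈ p) xs → length xs ≤ ∣ p ∣
  length≤∣∣ {xs = []}     _          _          = z≤n
  length≤∣∣ {p = p} {x ∷ xs} (x∉ ∷ xs!) (x∈ ∷ xs∈) = begin-strict
    length xs    ≤⟨ length≤∣∣ xs! (All.zipWith (λ (y∈ , x≢y) → x∈p∧x≢y⇒x∈p-y y∈ (x≢y ∘ sym)) (xs∈ , x∉)) ⟩
    ∣ p - x ∣    <⟨ x∈p⇒∣p-x∣<∣p∣ x∈ ⟩
    ∣ p ∣        ∎
    where open ≤-Reasoning

  ∣∣≤-injectiveOn : ∀ {n} (p : Subset n) (f : Fin n → ℕ) k →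
                    (∀ {v} → v ∈ p → f v < k) →
                    (∀ {u v} → u ∈ p → v ∈ p → f u ≡ f v → u ≡ v) → ∣ p ∣ ≤ k
  ∣∣≤-injectiveOn p f zero f<0 _ with elements p | length-elements p | elements-⊆ p
  ... | []    | len≡ | _       = ≤-reflexive (sym len≡)
  ... | _ ∷ _ | _    | v∈ ∷ _ = ⊥-elim (n≮0 (f<0 v∈))
  ∣∣≤-injectiveOn p f k@(suc _) f<k inj = begin
    ∣ p ∣                          ≡⟨ length-elements p ⟨
    length (elements p)            ≡⟨ length-map g (elements p) ⟨
    length (map g (elements p))    ≤⟨ length≤∣∣ (Unique-map⁺ g-inj (elements-⊆ p) (elements-unique p))
                                                 (All.map⁺ (All.universal (λ _ → ∈⊤) (elements p))) ⟩
    ∣ ⊤ {k} ∣                      ≡⟨ ∣⊤∣≡n k ⟩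
    k                              ∎
    where
    open ≤-Reasoning
    g : Fin _ → Fin k
    g v = f v mod k
    toℕ-g : ∀ {v} → v ∈ p → toℕ (g v) ≡ f v
    toℕ-g v∈ = trans (toℕ-fromℕ< _) (m<n⇒m%n≡m (f<k v∈))
    g-inj : ∀ {u v} → u ∈ p → v ∈ p → g u ≡ g v → u ≡ v
    g-inj u∈ v∈ gu≡gv = inj u∈ v∈ (trans (sym (toℕ-g u∈)) (trans (cong toℕ gu≡gv) (toℕ-g v∈)))

  ≤∣∣-injection : ∀ {n s} (p : Subset n) (g : Fin s → Fin n) →
                  (∀ i → g i ∈ p) → (∀ {i j} → g i ≡ g j → i ≡ j) → s ≤ ∣ p ∣
  ≤∣∣-injection {s = s} p g g∈ g-inj =
    subst (_≤ ∣ p ∣) (length-tabulate g) (length≤∣∣ (Unique.tabulate⁺ g-inj) (All.tabulate⁺ g∈))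

  ∣⁅x⁆∪⁅y⁆∣≡2 : ∀ {n} {x y : Fin n} → x ≢ y → ∣ ⁅ x ⁆ ∪ ⁅ y ⁆ ∣ ≡ 2
  ∣⁅x⁆∪⁅y⁆∣≡2 {x = zero}  {zero}  x≢y = ⊥-elim (x≢y refl)
  ∣⁅x⁆∪⁅y⁆∣≡2 {x = zero}  {suc y} _   = cong suc (trans (cong ∣_∣ (∪-identityˡ ⁅ y ⁆)) (∣⁅x⁆∣≡1 y))
  ∣⁅x⁆∪⁅y⁆∣≡2 {x = suc x} {zero}  _   = cong suc (trans (cong ∣_∣ (∪-identityʳ ⁅ x ⁆)) (∣⁅x⁆∣≡1 x))
  ∣⁅x⁆∪⁅y⁆∣≡2 {x = suc x} {suc y} x≢y = ∣⁅x⁆∪⁅y⁆∣≡2 (x≢y ∘ cong suc)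

  ∣p∪q∣≤∣p∣+∣q∣ : ∀ {n} (p q : Subset n) → ∣ p ∪ q ∣ ≤ ∣ p ∣ + ∣ q ∣
  ∣p∪q∣≤∣p∣+∣q∣ []            []            = z≤n
  ∣p∪q∣≤∣p∣+∣q∣ (inside ∷ p)  (inside ∷ q)  =
    s≤s (≤-trans (∣p∪q∣≤∣p∣+∣q∣ p q) (+-monoʳ-≤ ∣ p ∣ (n≤1+n ∣ q ∣)))
  ∣p∪q∣≤∣p∣+∣q∣ (inside ∷ p)  (outside ∷ q) = s≤s (∣p∪q∣≤∣p∣+∣q∣ p q)
  ∣p∪q∣≤∣p∣+∣q∣ (outside ∷ p) (inside ∷ q)  =
    ≤-trans (s≤s (∣p∪q∣≤∣p∣+∣q∣ p q)) (≤-reflexive (sym (+-suc ∣ p ∣ ∣ q ∣)))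
  ∣p∪q∣≤∣p∣+∣q∣ (outside ∷ p) (outside ∷ q) = ∣p∪q∣≤∣p∣+∣q∣ p q

  x∈p─q⇒x∉q : ∀ {n} (p q : Subset n) {x} → x ∈ p ─ q → x ∉ q
  x∈p─q⇒x∉q (inside ∷ p) (outside ∷ q) here      ()
  x∈p─q⇒x∉q (_ ∷ p)      (_ ∷ q)       (there x∈) (there x∈q) = x∈p─q⇒x∉q p q x∈ x∈q

  p⊆q⇒Empty[p─q] : ∀ {n} {p q : Subset n} → p ⊆ q → Empty (p ─ q)
  p⊆q⇒Empty[p─q] {p = p} {q} p⊆q (x , x∈) = x∈p─q⇒x∉q p q x∈ (p⊆q (p─q⊆p p q x∈))

  ⁅x⁆∪⁅y⁆⊆p : ∀ {n} {p : Subset n} {x y} → x ∈ p → y ∈ p → ⁅ x ⁆ ∪ ⁅ y ⁆ ⊆ p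
  ⁅x⁆∪⁅y⁆⊆p {x = x} {y} x∈ y∈ z∈ with x∈p∪q⁻ ⁅ x ⁆ ⁅ y ⁆ z∈
  ... | inj₁ z∈x = subst (_∈ _) (sym (x∈⁅y⁆⇒x≡y x z∈x)) x∈
  ... | inj₂ z∈y = subst (_∈ _) (sym (x∈⁅y⁆⇒x≡y y z∈y)) y∈

  does≡true⇒ : ∀ {P : Set} (P? : Dec P) → does P? ≡ true → P
  does≡true⇒ (yes p) _  = p
  does≡true⇒ (no _)  ()

  subsetOf : ∀ {n} {P : Fin n → Set} → Decidable P → Subset n
  subsetOf P? = Vec.tabulate (does ∘ P?)

  module _ {n} {P : Fin n → Set} (P? : Decidable P) where

    ∈-subsetOf⁺ : ∀ {v} → P v → v ∈ subsetOf P?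
    ∈-subsetOf⁺ {v} Pv = lookup⇒[]= v _ (trans (lookup∘tabulate _ v) (dec-true (P? v) Pv))

    ∈-subsetOf⁻ : ∀ {v} → v ∈ subsetOf P? → P v
    ∈-subsetOf⁻ {v} v∈ = does≡true⇒ (P? v) (trans (sym (lookup∘tabulate (does ∘ P?) v)) ([]=⇒lookup v∈))

    subsetOf-universal : (∀ v → P v) → subsetOf P? ≡ ⊤
    subsetOf-universal all = ⊆-antisym ⊆⊤ (λ _ → ∈-subsetOf⁺ (all _))

  module _ {n} {P Q : Fin n → Set} (P? : Decidable P) (Q? : Decidable Q) where

    subsetOf-≡ : (∀ v → P v ⇔ Q v) → subsetOf P? ≡ subsetOf Q?
    subsetOf-≡ P⇔Q = tabulate-cong (λ v → does-⇔ (P⇔Q v) (P? v) (Q? v))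

    subsetOf-─ : subsetOf P? ─ subsetOf Q? ≡ subsetOf (λ v → P? v ×-dec ¬? (Q? v))
    subsetOf-─ = ⊆-antisym
      (λ {v} v∈ → ∈-subsetOf⁺ (λ v → P? v ×-dec ¬? (Q? v))
         (∈-subsetOf⁻ P? (p─q⊆p _ _ v∈) , x∈p─q⇒x∉q _ _ v∈ ∘ ∈-subsetOf⁺ Q?))
      (λ {v} v∈ → let (Pv , ¬Qv) = ∈-subsetOf⁻ (λ v → P? v ×-dec ¬? (Q? v)) v∈ in
         x∈p∧x∉q⇒x∈p─q (∈-subsetOf⁺ P? Pv) (¬Qv ∘ ∈-subsetOf⁻ Q?))

  fiber : ∀ {n k} → (Fin n → Fin k) → Fin k → Subset n
  fiber π q = subsetOf (λ v → π v Finₚ.≟ q)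

  module _ {n k} (π : Fin n → Fin k) {q : Fin k} where

    ∈-fiber⁺ : ∀ {v} → π v ≡ q → v ∈ fiber π q
    ∈-fiber⁺ = ∈-subsetOf⁺ (λ v → π v Finₚ.≟ q)

    ∈-fiber⁻ : ∀ {v} → v ∈ fiber π q → π v ≡ q
    ∈-fiber⁻ = ∈-subsetOf⁻ (λ v → π v Finₚ.≟ q)

  𝟙 : Bool → ℕ
  𝟙 true  = 1
  𝟙 false = 0

  ∑1≡n : ∀ n → ∑ {n} (λ _ → 1) ≡ n
  ∑1≡n zero    = refl
  ∑1≡n (suc n) = cong suc (∑1≡n n)

  ∣∣≡∑𝟙 : ∀ {n} (p : Subset n) → ∣ p ∣ ≡ ∑ (𝟙 ∘ lookup p)
  ∣∣≡∑𝟙 []            = refl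
  ∣∣≡∑𝟙 (inside ∷ p)  = cong suc (∣∣≡∑𝟙 p)
  ∣∣≡∑𝟙 (outside ∷ p) = ∣∣≡∑𝟙 p

  count-∷ : ∀ (p : A → Bool) x xs →
            length (filterᵇ p (x ∷ xs)) ≡ 𝟙 (p x) + length (filterᵇ p xs)
  count-∷ p x xs with p x
  ... | true  = refl
  ... | false = refl

  count-++ : ∀ (p : A → Bool) xs ys →
             length (filterᵇ p (xs ++ ys)) ≡ length (filterᵇ p xs) + length (filterᵇ p ys)
  count-++ p xs ys = trans (cong length (filter-++ (T? ∘ p) xs ys)) (length-++ (filterᵇ p xs))

  count-map : ∀ (p : B → Bool) (f : A → B) xs →
              length (filterᵇ p (map f xs)) ≡ length (filterᵇ (p ∘ f) xs)
  count-map p f []       = refl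
  count-map p f (x ∷ xs) = begin
    length (filterᵇ p (f x ∷ map f xs))          ≡⟨ count-∷ p (f x) (map f xs) ⟩
    𝟙 (p (f x)) + length (filterᵇ p (map f xs))  ≡⟨ cong (𝟙 (p (f x)) +_) (count-map p f xs) ⟩
    𝟙 (p (f x)) + length (filterᵇ (p ∘ f) xs)    ≡⟨ count-∷ (p ∘ f) x xs ⟨
    length (filterᵇ (p ∘ f) (x ∷ xs))            ∎
    where open ≡-Reasoning

  count-tabulate : ∀ {n} (p : A → Bool) (f : Fin n → A) →
                   length (filterᵇ p (tabulate f)) ≡ ∑ (λ i → 𝟙 (p (f i)))
  count-tabulate {n = zero}  p f = refl
  count-tabulate {n = suc n} p f =
    trans (count-∷ p (f zero) _) (cong (𝟙 (p (f zero)) +_) (count-tabulate p (f ∘ suc)))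

  count-cartesianProduct : ∀ {n} (p : A × B → Bool) (f : Fin n → A) ys →
    length (filterᵇ p (cartesianProduct (tabulate f) ys))
      ≡ ∑ (λ i → length (filterᵇ (λ y → p (f i , y)) ys))
  count-cartesianProduct {n = zero}  p f ys = refl
  count-cartesianProduct {n = suc n} p f ys =
    trans (count-++ p (map (f zero ,_) ys) _)
          (cong₂ _+_ (count-map p (f zero ,_) ys) (count-cartesianProduct p (f ∘ suc) ys))

  ∑𝟙[x≟_]≡1 : ∀ {k} (x : Fin k) → ∑ (λ q → 𝟙 (does (x Finₚ.≟ q))) ≡ 1
  ∑𝟙[x≟_]≡1 {suc k} zero    = cong suc (sum-replicate-zero k)
  ∑𝟙[x≟_]≡1         (suc x) = ∑𝟙[x≟_]≡1 x

  ∑-ordered-pairs : ∀ {n} (p : Subset n) →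
    ∑ (λ u → ∑ (λ v → 𝟙 ((toℕ u <ᵇ toℕ v) ∧ lookup p u ∧ lookup p v))) ≡ ∣ p ∣ C 2
  ∑-ordered-pairs []                    = refl
  ∑-ordered-pairs (inside ∷ p)          =
    trans (cong₂ _+_ (sym (∣∣≡∑𝟙 p)) (∑-ordered-pairs p)) (sym (suc-C2 ∣ p ∣))
  ∑-ordered-pairs {suc n} (outside ∷ p) = cong₂ _+_ (sum-replicate-zero n) (∑-ordered-pairs p)

  ∧-redundantʳ : ∀ a b c d → (T a → T b → T c → d ≡ true) → a ∧ b ∧ c ∧ d ≡ a ∧ b ∧ c
  ∧-redundantʳ true  true  true  d d≡true = d≡true _ _ _
  ∧-redundantʳ true  true  false d _      = refl
  ∧-redundantʳ true  false c     d _      = refl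
  ∧-redundantʳ false b     c     d _      = refl

module CliqueGraphs (G : Graph) where

  open import Data.Bool using (Bool; true; false; _∧_; T)
  open import Data.Nat using (suc; _+_; _*_; _≤_; _<ᵇ_; z≤n)
  open import Data.Nat.Properties
  open import Data.Nat.Combinatorics using (_C_)
  open import Data.Nat.ListAction using (sum)
  open import Data.Fin using (Fin; toℕ)
  import Data.Fin.Properties as Finₚ
  open import Data.Fin.Subset using (Subset; _∈_; _⊆_; _∪_; ⁅_⁆; ∣_∣)
  open import Data.Fin.Subset.Properties
    using (∈⊤; ∣⊥∣≡0; ∣⁅x⁆∣≡1; p⊆q⇒∣p∣≤∣q∣; x∈p∪q⁻; x∈p∪q⁺; x∈⁅x⁆; x∈⁅y⁆⇒x≡y)
  open import Data.Vec using (lookup)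
  open import Data.Vec.Properties using (lookup⇒[]=; lookup∘tabulate)
  open import Data.List using ([]; _∷_; length; map; filterᵇ; allFin)
  open import Data.List.Relation.Unary.All as All using (All; []; _∷_)
  open import Data.List.Relation.Unary.All.Properties as All using ()
  open import Data.List.Relation.Unary.Any as Any using ()
  open import Data.List.Membership.Propositional using () renaming (_∈_ to _∈ₗ_)
  import Data.Product as Product
  open import Data.Product using (_×_; _,_; proj₁; proj₂)
  open import Data.Sum using (inj₁; inj₂)
  open import Data.Empty using (⊥-elim)
  open import Data.Bool.Properties using (T-≡)
  open import Function using (_∘_; Equivalence)
  open import Relation.Nullary using (does)
  open import Relation.Binary.PropositionalEquality
  open import Algebra.Properties.CommutativeMonoid.Sum +-0-commutativeMonoid
    using (sum-cong-≗; ∑-distrib-+; sum-replicate-zero) renaming (sum to ∑)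

  open Arithmetic
  open Counting

  private
    T⇒∈ : ∀ {X : Subset (n G)} {v} → T (lookup X v) → v ∈ X
    T⇒∈ {X} {v} t = lookup⇒[]= v X (Equivalence.to T-≡ t)

  edgesWithin-clique : ∀ {X} → IsClique G X → edgesWithin G X ≡ ∣ X ∣ C 2
  edgesWithin-clique {X} X-clique = begin
    edgesWithin G X
      ≡⟨ count-cartesianProduct (λ (u , v) → edgeIn u v) (λ u → u) (allFin (n G)) ⟩
    ∑ (λ u → length (filterᵇ (λ v → edgeIn u v) (allFin (n G))))
      ≡⟨ sum-cong-≗ (λ u → count-tabulate (λ v → edgeIn u v) (λ v → v)) ⟩
    ∑ (λ u → ∑ (λ v → 𝟙 (edgeIn u v)))
      ≡⟨ sum-cong-≗ (λ u → sum-cong-≗ (λ v → cong 𝟙 (adj-redundant u v))) ⟩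
    ∑ (λ u → ∑ (λ v → 𝟙 (inX u v)))
      ≡⟨ ∑-ordered-pairs X ⟩
    ∣ X ∣ C 2
      ∎
    where
    open ≡-Reasoning
    inX edgeIn : V G → V G → Bool
    inX u v    = (toℕ u <ᵇ toℕ v) ∧ lookup X u ∧ lookup X v
    edgeIn u v = (toℕ u <ᵇ toℕ v) ∧ lookup X u ∧ lookup X v ∧ adj G u v
    adj-redundant : ∀ u v → edgeIn u v ≡ inX u v
    adj-redundant u v = ∧-redundantʳ (toℕ u <ᵇ toℕ v) _ _ _ λ u<v u∈ v∈ →
      X-clique u v (T⇒∈ u∈) (T⇒∈ v∈) (<⇒≢ (<ᵇ⇒< (toℕ u) (toℕ v) u<v) ∘ cong toℕ)

  multiplicity-∷ : ∀ X Xs v → multiplicity G (X ∷ Xs) v ≡ 𝟙 (lookup X v) + multiplicity G Xs v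
  multiplicity-∷ X Xs v with lookup X v
  ... | true  = refl
  ... | false = refl

  ∑-multiplicity : ∀ Xs → ∑ (multiplicity G Xs) ≡ sum (map ∣_∣ Xs)
  ∑-multiplicity []       = sum-replicate-zero (n G)
  ∑-multiplicity (X ∷ Xs) = begin
    ∑ (multiplicity G (X ∷ Xs))                     ≡⟨ sum-cong-≗ (multiplicity-∷ X Xs) ⟩
    ∑ (λ v → 𝟙 (lookup X v) + multiplicity G Xs v) ≡⟨ ∑-distrib-+ (𝟙 ∘ lookup X) (multiplicity G Xs) ⟩
    ∑ (𝟙 ∘ lookup X) + ∑ (multiplicity G Xs)       ≡⟨ cong₂ _+_ (sym (∣∣≡∑𝟙 X)) (∑-multiplicity Xs) ⟩
    ∣ X ∣ + sum (map ∣_∣ Xs)                         ∎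
    where open ≡-Reasoning

  cliquePartition-∑∣∣≡n : ∀ {Xs} → IsCliquePartition G Xs → sum (map ∣_∣ Xs) ≡ n G
  cliquePartition-∑∣∣≡n {Xs} (_ , once) =
    trans (sym (∑-multiplicity Xs)) (trans (sum-cong-≗ once) (∑1≡n (n G)))

  2*numEdges≤s*∑∣∣ : ∀ {s} → (∀ X → IsClique G X → ∣ X ∣ ≤ suc s) →
                ∀ {Xs} → All (IsClique G) Xs → 2 * numEdges G Xs ≤ s * sum (map ∣_∣ Xs)
  2*numEdges≤s*∑∣∣ ω≤ []                        = z≤n
  2*numEdges≤s*∑∣∣ {s} ω≤ {X ∷ Xs} (X-clique ∷ cliques) = begin
    2 * (edgesWithin G X + numEdges G Xs)
      ≡⟨ *-distribˡ-+ 2 (edgesWithin G X) _ ⟩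
    2 * edgesWithin G X + 2 * numEdges G Xs
      ≡⟨ cong (λ e → 2 * e + 2 * numEdges G Xs) (edgesWithin-clique X-clique) ⟩
    2 * (∣ X ∣ C 2) + 2 * numEdges G Xs
      ≤⟨ +-mono-≤ (a≤1+s⇒2*aC2≤a*s (ω≤ X X-clique)) (2*numEdges≤s*∑∣∣ ω≤ cliques) ⟩
    ∣ X ∣ * s + s * sum (map ∣_∣ Xs)
      ≡⟨ cong (_+ s * sum (map ∣_∣ Xs)) (*-comm ∣ X ∣ s) ⟩
    s * ∣ X ∣ + s * sum (map ∣_∣ Xs)
      ≡⟨ *-distribˡ-+ s ∣ X ∣ _ ⟨
    s * (∣ X ∣ + sum (map ∣_∣ Xs))
      ∎
    where open ≤-Reasoning

  cliquePartition-2*numEdges≤s*n : ∀ {s Xs} → CliqueNumber G (suc s) → IsCliquePartition G Xs →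
                                2 * numEdges G Xs ≤ s * n G
  cliquePartition-2*numEdges≤s*n {s} {Xs} (_ , ω≤) Xs-part@(parts , _) =
    subst (λ k → 2 * numEdges G Xs ≤ s * k) (cliquePartition-∑∣∣≡n Xs-part)
          (2*numEdges≤s*∑∣∣ (λ X X-clique → ω≤ X (λ _ → ∈⊤) X-clique) (All.map proj₂ parts))

  pair-clique : ∀ {u v} → adj G u v ≡ true → IsClique G (⁅ u ⁆ ∪ ⁅ v ⁆)
  pair-clique {u} {v} uv x y x∈ y∈ x≢y with x∈p∪q⁻ ⁅ u ⁆ ⁅ v ⁆ x∈ | x∈p∪q⁻ ⁅ u ⁆ ⁅ v ⁆ y∈
  ... | inj₁ x∈u | inj₁ y∈u = ⊥-elim (x≢y (trans (x∈⁅y⁆⇒x≡y u x∈u) (sym (x∈⁅y⁆⇒x≡y u y∈u))))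
  ... | inj₂ x∈v | inj₂ y∈v = ⊥-elim (x≢y (trans (x∈⁅y⁆⇒x≡y v x∈v) (sym (x∈⁅y⁆⇒x≡y v y∈v))))
  ... | inj₁ x∈u | inj₂ y∈v rewrite x∈⁅y⁆⇒x≡y u x∈u | x∈⁅y⁆⇒x≡y v y∈v = uv
  ... | inj₂ x∈v | inj₁ y∈u rewrite x∈⁅y⁆⇒x≡y v x∈v | x∈⁅y⁆⇒x≡y u y∈u = trans (Graph.sym G v u) uv

  adj⇒≢ : ∀ {u v} → adj G u v ≡ true → u ≢ v
  adj⇒≢ {u} uv refl with trans (sym uv) (irrefl G u)
  ... | ()

  edgesWithin-edge : ∀ {u v} → adj G u v ≡ true → edgesWithin G (⁅ u ⁆ ∪ ⁅ v ⁆) ≡ 1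
  edgesWithin-edge uv = trans (edgesWithin-clique (pair-clique uv)) (cong (_C 2) (∣⁅x⁆∪⁅y⁆∣≡2 (adj⇒≢ uv)))

  length-endpoints : ∀ M → length (endpoints G M) ≡ 2 * length M
  length-endpoints []      = refl
  length-endpoints (_ ∷ M) = trans (cong (2 +_) (length-endpoints M)) (sym (*-suc 2 (length M)))

  matching-2*length≤ : ∀ {R M} → IsMatchingIn G R M → 2 * length M ≤ ∣ R ∣
  matching-2*length≤ {R} {M} (edges , unique) =
    subst (_≤ ∣ R ∣) (length-endpoints M)
          (length≤∣∣ unique (All.concat⁺ (All.map⁺ (All.map (λ (_ , u∈ , v∈) → u∈ ∷ v∈ ∷ []) edges))))

  ∈-matchedVertices : ∀ {u v M} → (u , v) ∈ₗ M → u ∈ matchedVertices G M × v ∈ matchedVertices G M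
  ∈-matchedVertices (Any.here refl) =
    x∈p∪q⁺ (inj₁ (x∈p∪q⁺ (inj₁ (x∈⁅x⁆ _)))) , x∈p∪q⁺ (inj₁ (x∈p∪q⁺ (inj₂ (x∈⁅x⁆ _))))
  ∈-matchedVertices (Any.there e∈) =
    Product.map (x∈p∪q⁺ ∘ inj₂) (x∈p∪q⁺ ∘ inj₂) (∈-matchedVertices e∈)

  ∣matchedVertices∣≤2*length : ∀ M → ∣ matchedVertices G M ∣ ≤ 2 * length M
  ∣matchedVertices∣≤2*length []            = ≤-reflexive (∣⊥∣≡0 (n G))
  ∣matchedVertices∣≤2*length ((u , v) ∷ M) = begin
    ∣ (⁅ u ⁆ ∪ ⁅ v ⁆) ∪ matchedVertices G M ∣       ≤⟨ ∣p∪q∣≤∣p∣+∣q∣ (⁅ u ⁆ ∪ ⁅ v ⁆) _ ⟩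
    ∣ ⁅ u ⁆ ∪ ⁅ v ⁆ ∣ + ∣ matchedVertices G M ∣     ≤⟨ +-mono-≤ ∣pair∣≤2 (∣matchedVertices∣≤2*length M) ⟩
    2 + 2 * length M                                ≡⟨ *-suc 2 (length M) ⟨
    2 * suc (length M)                              ∎
    where
    open ≤-Reasoning
    ∣pair∣≤2 : ∣ ⁅ u ⁆ ∪ ⁅ v ⁆ ∣ ≤ 2
    ∣pair∣≤2 = ≤-trans (∣p∪q∣≤∣p∣+∣q∣ ⁅ u ⁆ ⁅ v ⁆) (≤-reflexive (cong₂ _+_ (∣⁅x⁆∣≡1 u) (∣⁅x⁆∣≡1 v)))

  covering-matching-max : ∀ {R M} → IsMatchingIn G R M → R ⊆ matchedVertices G M →
                          IsMaxMatchingIn G R M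
  covering-matching-max {R} {M} M-matching R⊆V[M] = M-matching , λ M′ M′-matching →
    *-cancelˡ-≤ 2 (begin
      2 * length M′               ≤⟨ matching-2*length≤ M′-matching ⟩
      ∣ R ∣                        ≤⟨ p⊆q⇒∣p∣≤∣q∣ R⊆V[M] ⟩
      ∣ matchedVertices G M ∣      ≤⟨ ∣matchedVertices∣≤2*length M ⟩
      2 * length M                ∎)
    where open ≤-Reasoning

  numEdges-edgeParts : ∀ {R M} → IsMatchingIn G R M → numEdges G (edgeParts G M) ≡ length M
  numEdges-edgeParts {M = M} (edges , _) = go M edges
    where
    go : ∀ M → All (λ e → adj G (proj₁ e) (proj₂ e) ≡ true × _) M → numEdges G (edgeParts G M) ≡ length M
    go []      []                = refl
    go (_ ∷ M) ((uv , _) ∷ edges) = cong₂ _+_ (edgesWithin-edge uv) (go M edges)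

  multiplicity-fibers : ∀ {k} (π : V G → Fin k) v → multiplicity G (map (fiber π) (allFin k)) v ≡ 1
  multiplicity-fibers {k} π v =
    trans (go (allFin k)) (trans (count-tabulate (λ q → does (π v Finₚ.≟ q)) (λ q → q)) (∑𝟙[x≟_]≡1 (π v)))
    where
    go : ∀ qs → multiplicity G (map (fiber π) qs) v ≡ length (filterᵇ (λ q → does (π v Finₚ.≟ q)) qs)
    go []       = refl
    go (q ∷ qs) = begin
      multiplicity G (fiber π q ∷ map (fiber π) qs) v
        ≡⟨ multiplicity-∷ (fiber π q) _ v ⟩
      𝟙 (lookup (fiber π q) v) + multiplicity G (map (fiber π) qs) v
        ≡⟨ cong₂ _+_ (cong 𝟙 (lookup∘tabulate _ v)) (go qs) ⟩
      𝟙 (does (π v Finₚ.≟ q)) + length (filterᵇ (λ q → does (π v Finₚ.≟ q)) qs)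
        ≡⟨ count-∷ (λ q → does (π v Finₚ.≟ q)) q qs ⟨
      length (filterᵇ (λ q → does (π v Finₚ.≟ q)) (q ∷ qs))
        ∎
      where open ≡-Reasoning

module Construction (k m : ℕ) {{_ : NonZero m}} (1≤k : 1 ≤ k)
                    (divides : ∀ {s} → 3 ≤ s → s ≤ suc k → s ∣ m) where

  open import Data.Bool using (true)
  open import Data.Nat
    using (zero; suc; _+_; _*_; _∸_; _<_; z≤n; s≤s; s≤s⁻¹; _<?_; _≤?_; >-nonZero⁻¹)
  open import Data.Nat.Properties
  open import Data.Nat.Combinatorics using (_C_)
  open import Data.Nat.DivMod using (_/_; _%_; m%n<n; m/n*n≡m; m<n*o⇒m/o<n)
  open import Data.Nat.Tactic.RingSolver using (solve-∀)
  open import Data.Fin using (Fin; zero; toℕ; quotient; remainder; combine; fromℕ<)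
  import Data.Fin.Properties as Finₚ
  open Finₚ using (toℕ-fromℕ<; remQuot-combine; combine-remQuot)
  open import Data.Fin.Subset using (Subset; _∈_; _⊆_; _─_; _∪_; ⁅_⁆; ⊤; ∣_∣)
  open import Data.Fin.Subset.Properties using (⊆⊤; ∣⊥∣≡0; _∈?_; nonempty?; Empty-unique)
  open import Data.List using (List; []; _∷_; length; map; allFin; cartesianProduct; _++_)
  open import Data.List.Properties using (length-map; length-tabulate; ++-identityʳ)
  open import Data.List.Relation.Unary.All as All using (All; []; _∷_)
  open import Data.List.Relation.Unary.All.Properties as All using ()
  open import Data.List.Relation.Unary.AllPairs using ([]; _∷_)
  open import Data.List.Relation.Unary.Unique.Propositional using (Unique)
  import Data.List.Relation.Unary.Unique.Propositional.Properties as Unique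
  open import Data.List.Membership.Propositional.Properties using (∈-map⁺; ∈-allFin)
  open import Data.Product using (Σ-syntax; _×_; _,_; proj₁; proj₂; uncurry)
  open import Data.Sum using (_⊎_; inj₁; inj₂)
  open import Data.Empty using (⊥-elim)
  open import Function using (_∘_; mk⇔)
  open import Relation.Nullary using (¬_; Dec; yes; no; does)
  open import Relation.Nullary.Decidable
    using (dec-true; dec-false; does-⇔; decidable-stable; _×-dec_; _⊎-dec_; ¬?)
  open import Relation.Unary using (Decidable)
  open import Relation.Binary.PropositionalEquality

  open Arithmetic
  open Counting

  N : ℕ
  N = m * suc k

  row : Fin N → Fin m
  row = quotient {m} (suc k)

  col : Fin N → Fin (suc k)
  col = remainder {m} (suc k)

  vertex : Fin m → Fin (suc k) → Fin N
  vertex = combine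

  row-vertex : ∀ q c → row (vertex q c) ≡ q
  row-vertex q c = cong proj₁ (remQuot-combine q c)

  col-vertex : ∀ q c → col (vertex q c) ≡ c
  col-vertex q c = cong proj₂ (remQuot-combine q c)

  vertex-injective : ∀ {u v} → row u ≡ row v → col u ≡ col v → u ≡ v
  vertex-injective {u} {v} r≡ c≡ =
    trans (sym (combine-remQuot {m} (suc k) u))
          (trans (cong₂ combine r≡ c≡) (combine-remQuot {m} (suc k) v))

  block : Fin N → ℕ
  block v = toℕ (row v) / suc (toℕ (col v))

  SameBlock : Fin N → Fin N → Set
  SameBlock u v = col u ≡ col v × block u ≡ block v

  Adj : Fin N → Fin N → Set
  Adj u v = u ≢ v × (row u ≡ row v ⊎ SameBlock u v)

  Adj? : ∀ u v → Dec (Adj u v)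
  Adj? u v = ¬? (u Finₚ.≟ v)
       ×-dec ((row u Finₚ.≟ row v) ⊎-dec ((col u Finₚ.≟ col v) ×-dec (block u ≟ block v)))

  Adj-sym : ∀ {u v} → Adj u v → Adj v u
  Adj-sym (u≢v , inj₁ r≡)         = u≢v ∘ sym , inj₁ (sym r≡)
  Adj-sym (u≢v , inj₂ (c≡ , b≡)) = u≢v ∘ sym , inj₂ (sym c≡ , sym b≡)

  G : Graph
  G = record
    { n      = N
    ; adj    = λ u v → does (Adj? u v)
    ; sym    = λ u v → does-⇔ (mk⇔ Adj-sym Adj-sym) (Adj? u v) (Adj? v u)
    ; irrefl = λ v → dec-false (Adj? v v) (λ (v≢v , _) → v≢v refl)
    }

  open CliqueGraphs G

  adj⁺ : ∀ {u v} → Adj u v → adj G u v ≡ true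
  adj⁺ {u} {v} = dec-true (Adj? u v)

  adj⁻ : ∀ {u v} → adj G u v ≡ true → Adj u v
  adj⁻ {u} {v} = does≡true⇒ (Adj? u v)

  clique-in-row-or-block : ∀ {Y} → IsClique G Y → ∀ {u} → u ∈ Y →
    (∀ {v} → v ∈ Y → row v ≡ row u) ⊎ (∀ {v} → v ∈ Y → SameBlock v u)
  clique-in-row-or-block {Y} Y-clique {u} u∈
    with Finₚ.any? (λ w → (w ∈? Y) ×-dec ¬? (row w Finₚ.≟ row u))
  ... | no ∄w = inj₁ λ {v} v∈ → decidable-stable (row v Finₚ.≟ row u) (λ r≢ → ∄w (v , v∈ , r≢))
  ... | yes (w , w∈ , rw≢ru) = inj₂ same-block
    where
    adjacent : ∀ {x y} → x ∈ Y → y ∈ Y → x ≢ y → Adj x y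
    adjacent x∈ y∈ x≢y = adj⁻ (Y-clique _ _ x∈ y∈ x≢y)
    w~u : SameBlock w u
    w~u with adjacent w∈ u∈ (rw≢ru ∘ cong row)
    ... | _ , inj₁ r≡ = ⊥-elim (rw≢ru r≡)
    ... | _ , inj₂ sb = sb
    same-block : ∀ {v} → v ∈ Y → SameBlock v u
    same-block {v} v∈ with v Finₚ.≟ u
    ... | yes refl = refl , refl
    ... | no v≢u with adjacent v∈ u∈ v≢u
    ...   | _ , inj₂ sb    = sb
    -- v is in u's row but w is in u's block: then v, w adjacent forces col v ≡ col w ≡ col u.
    ...   | _ , inj₁ rv≡ru with adjacent v∈ w∈ (λ v≡w → rw≢ru (trans (cong row (sym v≡w)) rv≡ru))
    ...     | _ , inj₁ rv≡rw       = ⊥-elim (rw≢ru (trans (sym rv≡rw) rv≡ru))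
    ...     | _ , inj₂ (cv≡cw , _) = ⊥-elim (v≢u (vertex-injective rv≡ru (trans cv≡cw (proj₁ w~u))))

  ∣∣≤-row : ∀ {Y r c} → (∀ {v} → v ∈ Y → row v ≡ r) → (∀ {v} → v ∈ Y → toℕ (col v) < c) → ∣ Y ∣ ≤ c
  ∣∣≤-row {Y} in-r col< = ∣∣≤-injectiveOn Y (toℕ ∘ col) _ col<
    (λ u∈ v∈ e → vertex-injective (trans (in-r u∈) (sym (in-r v∈))) (Finₚ.toℕ-injective e))

  ∣∣≤-block : ∀ {Y u c} → (∀ {v} → v ∈ Y → SameBlock v u) → toℕ (col u) < c → ∣ Y ∣ ≤ c
  ∣∣≤-block {Y} {u} {c} in-b cu<c =
    ∣∣≤-injectiveOn Y offset c (λ {v} _ → <-≤-trans (m%n<n (toℕ (row v)) d) cu<c) offset-injective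
    where
    d = suc (toℕ (col u))
    -- Inside a block, a row is determined by its remainder modulo the block size.
    offset : Fin N → ℕ
    offset v = toℕ (row v) % d
    block-at : ∀ {v} → v ∈ Y → toℕ (row v) / d ≡ block u
    block-at {v} v∈ =
      trans (cong (λ c → toℕ (row v) / suc (toℕ c)) (sym (proj₁ (in-b v∈)))) (proj₂ (in-b v∈))
    offset-injective : ∀ {x y} → x ∈ Y → y ∈ Y → offset x ≡ offset y → x ≡ y
    offset-injective x∈ y∈ e = vertex-injective
      (Finₚ.toℕ-injective (/%-injective _ _ d (trans (block-at x∈) (sym (block-at y∈))) e))
      (trans (proj₁ (in-b x∈)) (sym (proj₁ (in-b y∈))))

  clique-≤ : ∀ {Y c} → IsClique G Y → (∀ {v} → v ∈ Y → toℕ (col v) < c) → ∣ Y ∣ ≤ c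
  clique-≤ {Y} Y-clique col< with nonempty? Y
  ... | no empty = subst (_≤ _) (sym (trans (cong ∣_∣ (Empty-unique empty)) (∣⊥∣≡0 N))) z≤n
  ... | yes (u , u∈) with clique-in-row-or-block Y-clique u∈
  ...   | inj₁ in-row   = ∣∣≤-row in-row col<
  ...   | inj₂ in-block = ∣∣≤-block in-block (col< u∈)

  rowSet : Fin m → Subset N
  rowSet = fiber row

  rowSet-clique : ∀ q → IsClique G (rowSet q)
  rowSet-clique q u v u∈ v∈ u≢v = adj⁺ (u≢v , inj₁ (trans (∈-fiber⁻ row u∈) (sym (∈-fiber⁻ row v∈))))

  ∣rowSet∣ : ∀ q → ∣ rowSet q ∣ ≡ suc k
  ∣rowSet∣ q = ≤-antisym
    (clique-≤ (rowSet-clique q) (λ {v} _ → Finₚ.toℕ<n (col v)))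
    (≤∣∣-injection (rowSet q) (vertex q) (λ c → ∈-fiber⁺ row (row-vertex q c))
       (λ {c} {c′} e → trans (sym (col-vertex q c)) (trans (cong col e) (col-vertex q c′))))

  rows : List (Subset N)
  rows = map rowSet (allFin m)

  rows-partition : IsCliquePartition G rows
  rows-partition =
    All.map⁺ (All.tabulate⁺ λ q → (vertex q zero , ∈-fiber⁺ row (row-vertex q zero)) , rowSet-clique q) ,
    multiplicity-fibers row

  numEdges-rows : numEdges G rows ≡ m * (suc k C 2)
  numEdges-rows = trans (go (allFin m)) (cong (_* (suc k C 2)) (length-tabulate {n = m} (λ q → q)))
    where
    go : ∀ qs → numEdges G (map rowSet qs) ≡ length qs * (suc k C 2)
    go []       = refl
    go (q ∷ qs) =
      cong₂ _+_ (trans (edgesWithin-clique (rowSet-clique q)) (cong (_C 2) (∣rowSet∣ q))) (go qs)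

  row₀ : Fin m
  row₀ = fromℕ< (>-nonZero⁻¹ m)

  cliqueNumber : CliqueNumber G (suc k)
  cliqueNumber = (rowSet row₀ , ⊆⊤ , rowSet-clique row₀ , ∣rowSet∣ row₀)
               , λ Y _ Y-clique → clique-≤ Y-clique (λ {v} _ → Finₚ.toℕ<n (col v))

  isOpt-rows : IsOPT G (m * (suc k C 2))
  isOpt-rows = (rows , rows-partition , numEdges-rows) , λ Xs Xs-partition → *-cancelˡ-≤ 2 (begin
    2 * numEdges G Xs        ≤⟨ cliquePartition-2*numEdges≤s*n cliqueNumber Xs-partition ⟩
    k * (m * suc k)          ≡⟨ lemma k m ⟩
    m * (suc k * k)          ≡⟨ cong (m *_) (2*[1+a]C2≡[1+a]*a k) ⟨
    m * (2 * (suc k C 2))    ≡⟨ lemma′ m (suc k C 2) ⟩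
    2 * (m * (suc k C 2))    ∎)
    where
    open ≤-Reasoning
    lemma : ∀ k m → k * (m * suc k) ≡ m * (suc k * k)
    lemma = solve-∀
    lemma′ : ∀ m x → m * (2 * x) ≡ 2 * (m * x)
    lemma′ = solve-∀

  vertex-row-col : ∀ {v c} → col v ≡ c → v ≡ vertex (row v) c
  vertex-row-col {v} {c} c≡ =
    vertex-injective (sym (row-vertex (row v) c)) (trans c≡ (sym (col-vertex (row v) c)))

  InBlock : ℕ → ℕ → Fin N → Set
  InBlock c b v = toℕ (col v) ≡ c × block v ≡ b

  -- What greedy leaves once it has removed the columns after c and the blocks 0, …, b − 1 of column c.
  Remaining : ℕ → ℕ → Fin N → Set
  Remaining c b v = toℕ (col v) < c ⊎ (toℕ (col v) ≡ c × b ≤ block v)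

  InBlock? : ∀ c b → Decidable (InBlock c b)
  InBlock? c b v = (toℕ (col v) ≟ c) ×-dec (block v ≟ b)

  Remaining? : ∀ c b → Decidable (Remaining c b)
  Remaining? c b v = (toℕ (col v) <? c) ⊎-dec ((toℕ (col v) ≟ c) ×-dec (b ≤? block v))

  blockSet remaining : ℕ → ℕ → Subset N
  blockSet  c b = subsetOf (InBlock? c b)
  remaining c b = subsetOf (Remaining? c b)

  Remaining⇒col≤ : ∀ {c b v} → Remaining c b v → toℕ (col v) ≤ c
  Remaining⇒col≤ (inj₁ col<c)      = <⇒≤ col<c
  Remaining⇒col≤ (inj₂ (col≡c , _)) = ≤-reflexive col≡c

  col≤⇒Remaining : ∀ {c v} → toℕ (col v) ≤ c → Remaining c 0 v
  col≤⇒Remaining col≤c with m≤n⇒m<n∨m≡n col≤c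
  ... | inj₁ col<c = inj₁ col<c
  ... | inj₂ col≡c = inj₂ (col≡c , z≤n)

  remaining-clique-≤ : ∀ {c b Y} → IsClique G Y → Y ⊆ remaining c b → ∣ Y ∣ ≤ suc c
  remaining-clique-≤ {c} {b} Y-clique Y⊆ =
    clique-≤ Y-clique (λ v∈ → s≤s (Remaining⇒col≤ (∈-subsetOf⁻ (Remaining? c b) (Y⊆ v∈))))

  remaining-top : remaining k 0 ≡ ⊤
  remaining-top = subsetOf-universal (Remaining? k 0) (λ v → col≤⇒Remaining (s≤s⁻¹ (Finₚ.toℕ<n (col v))))

  remaining-─-blockSet : ∀ c b → remaining c b ─ blockSet c b ≡ remaining c (suc b)
  remaining-─-blockSet c b =
    trans (subsetOf-─ (Remaining? c b) (InBlock? c b))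
          (subsetOf-≡ (λ v → Remaining? c b v ×-dec ¬? (InBlock? c b v)) (Remaining? c (suc b))
                      (λ v → mk⇔ to from))
    where
    to : ∀ {v} → Remaining c b v × ¬ InBlock c b v → Remaining c (suc b) v
    to (inj₁ col<c , _)           = inj₁ col<c
    to (inj₂ (col≡c , b≤) , ¬in) = inj₂ (col≡c , ≤∧≢⇒< b≤ (λ b≡ → ¬in (col≡c , sym b≡)))
    from : ∀ {v} → Remaining c (suc b) v → Remaining c b v × ¬ InBlock c b v
    from (inj₁ col<c)        = inj₁ col<c , λ (col≡c , _) → <-irrefl col≡c col<c
    from (inj₂ (col≡c , b<)) = inj₂ (col≡c , <⇒≤ b<) , λ (_ , b≡) → <-irrefl (sym b≡) b<

  block<m/d : ∀ {c v} → suc c ∣ m → toℕ (col v) ≡ c → block v < m / suc c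
  block<m/d {c} {v} d∣m refl =
    m<n*o⇒m/o<n (subst (toℕ (row v) <_) (sym (m/n*n≡m d∣m)) (Finₚ.toℕ<n (row v)))

  remaining-exhausted : ∀ c → suc (suc c) ∣ m → remaining (suc c) (m / suc (suc c)) ≡ remaining c 0
  remaining-exhausted c d∣m = subsetOf-≡ (Remaining? (suc c) _) (Remaining? c 0) (λ v → mk⇔ to from)
    where
    to : ∀ {v} → Remaining (suc c) (m / suc (suc c)) v → Remaining c 0 v
    to (inj₁ col<1+c)         = col≤⇒Remaining (s≤s⁻¹ col<1+c)
    to (inj₂ (col≡1+c , B≤)) = ⊥-elim (<⇒≱ (block<m/d d∣m col≡1+c) B≤)
    from : ∀ {v} → Remaining c 0 v → Remaining (suc c) (m / suc (suc c)) v
    from rem = inj₁ (s≤s (Remaining⇒col≤ rem))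

  blockSet-clique : ∀ c b → IsClique G (blockSet c b)
  blockSet-clique c b u v u∈ v∈ u≢v with ∈-subsetOf⁻ (InBlock? c b) u∈ | ∈-subsetOf⁻ (InBlock? c b) v∈
  ... | cu , bu | cv , bv = adj⁺ (u≢v , inj₂ (Finₚ.toℕ-injective (trans cu (sym cv)) , trans bu (sym bv)))

  blockSet⊆remaining : ∀ c b → blockSet c b ⊆ remaining c b
  blockSet⊆remaining c b v∈ with ∈-subsetOf⁻ (InBlock? c b) v∈
  ... | col≡c , block≡b = ∈-subsetOf⁺ (Remaining? c b) (inj₂ (col≡c , ≤-reflexive (sym block≡b)))

  module Block (c b : ℕ) (2≤c : 2 ≤ c) (c<ℓ : c < suc k) (b<B : b < m / suc c) where

    d∣m : suc c ∣ m
    d∣m = divides (s≤s 2≤c) c<ℓ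

    blockRow : Fin (suc c) → Fin m
    blockRow p = fromℕ< (p+b*d<m d∣m (Finₚ.toℕ<n p) b<B)

    toℕ-blockRow : ∀ p → toℕ (blockRow p) ≡ toℕ p + b * suc c
    toℕ-blockRow p = toℕ-fromℕ< _

    member : Fin (suc c) → Fin N
    member p = vertex (blockRow p) (fromℕ< c<ℓ)

    member∈ : ∀ p → member p ∈ blockSet c b
    member∈ p = ∈-subsetOf⁺ (InBlock? c b) (col≡c , block≡b)
      where
      row≡ : toℕ (row (member p)) ≡ toℕ p + b * suc c
      row≡ = trans (cong toℕ (row-vertex _ _)) (toℕ-blockRow p)
      col≡c : toℕ (col (member p)) ≡ c
      col≡c = trans (cong toℕ (col-vertex _ _)) (toℕ-fromℕ< c<ℓ)
      block≡b : block (member p) ≡ b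
      block≡b = trans (cong₂ (λ r c → r / suc c) row≡ col≡c)
                      ([p+b*d]/d≡b (toℕ p) b (suc c) (Finₚ.toℕ<n p))

    member-injective : ∀ {p p′} → member p ≡ member p′ → p ≡ p′
    member-injective {p} {p′} e = Finₚ.toℕ-injective (+-cancelʳ-≡ _ (toℕ p) (toℕ p′) (begin
      toℕ p + b * suc c    ≡⟨ toℕ-blockRow p ⟨
      toℕ (blockRow p)     ≡⟨ cong toℕ (trans (sym (row-vertex _ _)) (trans (cong row e) (row-vertex _ _))) ⟩
      toℕ (blockRow p′)    ≡⟨ toℕ-blockRow p′ ⟩
      toℕ p′ + b * suc c   ∎))
      where open ≡-Reasoning

    ∣blockSet∣ : ∣ blockSet c b ∣ ≡ suc c
    ∣blockSet∣ = ≤-antisym (remaining-clique-≤ {c} {b} (blockSet-clique c b) (blockSet⊆remaining c b))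
                           (≤∣∣-injection _ member member∈ member-injective)

    blockSet-max : IsMaxCliqueIn G (remaining c b) (blockSet c b)
    blockSet-max = blockSet⊆remaining c b , blockSet-clique c b , λ Y Y⊆ Y-clique →
      subst (∣ Y ∣ ≤_) (sym ∣blockSet∣) (remaining-clique-≤ {c} {b} Y-clique Y⊆)

    ¬ω≡2 : ¬ CliqueNumberIn G (remaining c b) 2
    ¬ω≡2 (_ , ω≤2) = <⇒≱ (subst (2 <_) (sym ∣blockSet∣) (s≤s 2≤c))
                         (ω≤2 _ (blockSet⊆remaining c b) (blockSet-clique c b))

    greedy-block : ∀ {Xs} → GreedyRun G (remaining c (suc b)) Xs →
                   GreedyRun G (remaining c b) (blockSet c b ∷ Xs)
    greedy-block {Xs} run =
      clique (member zero , blockSet⊆remaining c b (member∈ zero)) ¬ω≡2 blockSet-max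
             (subst (λ R → GreedyRun G R Xs) (sym (remaining-─-blockSet c b)) run)

    numEdges-blockSet : edgesWithin G (blockSet c b) ≡ suc c C 2
    numEdges-blockSet = trans (edgesWithin-clique (blockSet-clique c b)) (cong (_C 2) ∣blockSet∣)

  greedy-column : ∀ {c Xs} → 2 ≤ c → c < suc k → GreedyRun G (remaining c (m / suc c)) Xs →
    ∀ j → j ≤ m / suc c →
    Σ[ Ys ∈ List (Subset N) ] GreedyRun G (remaining c (m / suc c ∸ j)) Ys
                            × numEdges G Ys ≡ j * (suc c C 2) + numEdges G Xs
  greedy-column _ _ run zero _ = _ , run , refl
  greedy-column {c} {Xs} 2≤c c<ℓ run (suc j) j<B with greedy-column 2≤c c<ℓ run j (<⇒≤ j<B)
  ... | Ys , run′ , edges =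
    blockSet c b ∷ Ys ,
    greedy-block (subst (λ b → GreedyRun G (remaining c b) Ys) (sym 1+b≡) run′) ,
    trans (cong₂ _+_ numEdges-blockSet edges) (sym (+-assoc (suc c C 2) _ _))
    where
    b = m / suc c ∸ suc j
    1+b≡ : suc b ≡ m / suc c ∸ j
    1+b≡ = sym (+-∸-assoc 1 j<B)
    open Block c b 2≤c c<ℓ (≤-trans (≤-reflexive 1+b≡) (m∸n≤m _ j))

  c₁ : Fin (suc k)
  c₁ = fromℕ< (s≤s 1≤k)

  toℕ-c₁ : toℕ c₁ ≡ 1
  toℕ-c₁ = toℕ-fromℕ< (s≤s 1≤k)

  zero≢c₁ : zero ≢ c₁
  zero≢c₁ e = 0≢1+n (trans (cong toℕ e) toℕ-c₁)

  rung : Fin m → Fin N × Fin N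
  rung q = vertex q zero , vertex q c₁

  ladder : Matching G
  ladder = map rung (allFin m)

  rung-adj : ∀ q → Adj (vertex q zero) (vertex q c₁)
  rung-adj q = (λ e → zero≢c₁ (trans (sym (col-vertex q zero)) (trans (cong col e) (col-vertex q c₁))))
             , inj₁ (trans (row-vertex q zero) (sym (row-vertex q c₁)))

  rung⊆remaining : ∀ q → vertex q zero ∈ remaining 1 0 × vertex q c₁ ∈ remaining 1 0
  rung⊆remaining q = in-remaining (subst (_≤ 1) (sym (cong toℕ (col-vertex q zero))) z≤n)
                   , in-remaining (≤-reflexive (trans (cong toℕ (col-vertex q c₁)) toℕ-c₁))
    where
    in-remaining : ∀ {v} → toℕ (col v) ≤ 1 → v ∈ remaining 1 0
    in-remaining = ∈-subsetOf⁺ (Remaining? 1 0) ∘ col≤⇒Remaining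

  endpoints-ladder : ∀ qs →
    endpoints G (map rung qs) ≡ map (uncurry vertex) (cartesianProduct qs (zero ∷ c₁ ∷ []))
  endpoints-ladder []       = refl
  endpoints-ladder (q ∷ qs) = cong (λ vs → vertex q zero ∷ vertex q c₁ ∷ vs) (endpoints-ladder qs)

  ladder-matching : IsMatchingIn G (remaining 1 0) ladder
  ladder-matching =
    All.map⁺ (All.tabulate⁺ λ q → adj⁺ (rung-adj q) , rung⊆remaining q) ,
    subst Unique (sym (endpoints-ladder (allFin m)))
      (Unique.map⁺ (λ {(q , c)} {(q′ , c′)} e → uncurry (cong₂ _,_) (Finₚ.combine-injective q c q′ c′ e))
                   (Unique.cartesianProduct⁺ (Unique.allFin⁺ m) ((zero≢c₁ ∷ []) ∷ [] ∷ [])))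

  rung∈ladder : ∀ q → vertex q zero ∈ matchedVertices G ladder × vertex q c₁ ∈ matchedVertices G ladder
  rung∈ladder q = ∈-matchedVertices (∈-map⁺ rung (∈-allFin q))

  remaining⊆ladder : remaining 1 0 ⊆ matchedVertices G ladder
  remaining⊆ladder {v} v∈ with ∈-subsetOf⁻ (Remaining? 1 0) v∈
  ... | inj₁ col<1 = subst (_∈ matchedVertices G ladder)
                           (sym (vertex-row-col (Finₚ.toℕ-injective (n<1⇒n≡0 col<1))))
                           (proj₁ (rung∈ladder (row v)))
  ... | inj₂ (col≡1 , _) = subst (_∈ matchedVertices G ladder)
                                 (sym (vertex-row-col (Finₚ.toℕ-injective (trans col≡1 (sym toℕ-c₁)))))
                                 (proj₂ (rung∈ladder (row v)))

  ω≡2 : CliqueNumberIn G (remaining 1 0) 2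
  ω≡2 = ( ⁅ vertex row₀ zero ⁆ ∪ ⁅ vertex row₀ c₁ ⁆
        , ⁅x⁆∪⁅y⁆⊆p (proj₁ (rung⊆remaining row₀)) (proj₂ (rung⊆remaining row₀))
        , pair-clique (adj⁺ (rung-adj row₀))
        , ∣⁅x⁆∪⁅y⁆∣≡2 (proj₁ (rung-adj row₀)))
      , λ Y Y⊆ Y-clique → remaining-clique-≤ {1} {0} Y-clique Y⊆

  greedy-ladder : GreedyRun G (remaining 1 0) (edgeParts G ladder ++ [])
  greedy-ladder = matching (_ , proj₁ (rung⊆remaining row₀)) ω≡2
    (covering-matching-max ladder-matching remaining⊆ladder) (stop (p⊆q⇒Empty[p─q] remaining⊆ladder))

  numEdges-ladder : numEdges G (edgeParts G ladder ++ []) ≡ m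
  numEdges-ladder = begin
    numEdges G (edgeParts G ladder ++ []) ≡⟨ cong (numEdges G) (++-identityʳ (edgeParts G ladder)) ⟩
    numEdges G (edgeParts G ladder)       ≡⟨ numEdges-edgeParts ladder-matching ⟩
    length ladder                          ≡⟨ length-map rung (allFin m) ⟩
    length (allFin m)                      ≡⟨ length-tabulate (λ q → q) ⟩
    m                                      ∎
    where open ≡-Reasoning

  greedy-from : ∀ c → 1 ≤ c → c < suc k →
    Σ[ Xs ∈ List (Subset N) ] GreedyRun G (remaining c 0) Xs × 2 * numEdges G Xs ≡ m * (suc c C 2 + 1)
  greedy-from 1 _ _ = _ , greedy-ladder , trans (cong (2 *_) numEdges-ladder) (*-comm 2 m)
  greedy-from (suc (suc c)) _ c<ℓ =
    let Xs , run , edges    = greedy-from (suc c) (s≤s z≤n) (<⇒≤ c<ℓ)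
        Ys , run′ , edges′ = greedy-column (s≤s (s≤s z≤n)) c<ℓ
                               (subst (λ R → GreedyRun G R Xs) (sym (remaining-exhausted (suc c) d∣m)) run)
                               (m / suc (suc (suc c))) ≤-refl
    in Ys , subst (λ b → GreedyRun G (remaining (suc (suc c)) b) Ys) (n∸n≡0 (m / suc (suc (suc c)))) run′
          , trans (cong (2 *_) edges′)
                  (2*[B*C+E]≡m*[C+1] (m / suc (suc (suc c))) (suc (suc c)) m (numEdges G Xs) (m/n*n≡m d∣m) edges)
    where
    d∣m : suc (suc (suc c)) ∣ m
    d∣m = divides (s≤s (s≤s (s≤s z≤n))) c<ℓ

  greedy-run : Σ[ Xs ∈ List (Subset N) ] GreedyOutput G Xs × 2 * numEdges G Xs ≡ m * (suc k C 2 + 1)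
  greedy-run with greedy-from k 1≤k ≤-refl
  ... | Xs , run , edges = Xs , subst (λ R → GreedyRun G R Xs) remaining-top run , edges

  construction : Instance (suc k)
  construction = record
    { graph     = G
    ; partition = proj₁ greedy-run
    ; opt       = m * (suc k C 2)
    ; ω≡ℓ       = cliqueNumber
    ; greedy    = proj₁ (proj₂ greedy-run)
    ; isOpt     = isOpt-rows
    }

import Data.Rational as ℚ
open import Data.Rational using (ℚ; 0ℚ; 1ℚ; _<_; _-_; ∣_∣; toℚᵘ)
open import Data.Rational.Properties using (toℚᵘ-injective; toℚᵘ-fromℚᵘ; toℚᵘ-homo-*)
import Data.Rational.Unnormalised as ℚᵘ
import Data.Rational.Unnormalised.Properties as ℚᵘ
open import Data.Rational.Unnormalised using (mkℚᵘ; *≡*)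
import Data.Integer as ℤ
import Data.Integer.Properties as ℤ
open import Data.Integer using (+_)
open import Data.Nat using (zero; _+_; _*_; z≤n; s≤s; _!)
open import Data.Nat.Properties using (0≢1+n; ≤-trans; m≤m+n; _!≢0; 1≤n!)
open Arithmetic using (suc-C2)
open import Data.Nat.Combinatorics using (_C_)
open import Data.Nat.Divisibility using (∣-trans; m∣m*n; m≤n⇒m!∣n!)
open import Data.Nat.Tactic.RingSolver using (solve-∀)
open import Data.Product using (Σ; ∃; _,_; proj₁; proj₂)
open import Data.Empty using (⊥-elim)
open import Relation.Binary.PropositionalEquality using (_≡_; sym; trans; cong; subst; module ≡-Reasoning)

frac*frac≡1 : ∀ a b c d → a * c ≡ suc b * suc d → frac a (suc b) ℚ.* frac c (suc d) ≡ 1ℚ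
frac*frac≡1 a b c d a*c≡ = toℚᵘ-injective (begin
  toℚᵘ (frac a (suc b) ℚ.* frac c (suc d))          ≈⟨ toℚᵘ-homo-* (frac a (suc b)) (frac c (suc d)) ⟩
  toℚᵘ (frac a (suc b)) ℚᵘ.* toℚᵘ (frac c (suc d))  ≈⟨ ℚᵘ.*-cong (toℚᵘ-fromℚᵘ (mkℚᵘ (+ a) b))
                                                                  (toℚᵘ-fromℚᵘ (mkℚᵘ (+ c) d)) ⟩
  mkℚᵘ (+ a) b ℚᵘ.* mkℚᵘ (+ c) d                    ≈⟨ *≡* cross ⟩
  toℚᵘ 1ℚ                                            ∎)
  where
  open ℚᵘ.≃-Reasoning
  cross : (+ a ℤ.* + c) ℤ.* + 1 ≡ + 1 ℤ.* (+ suc b ℤ.* + suc d)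
  cross = trans (ℤ.*-identityʳ _) (trans (sym (ℤ.pos-* a c)) (trans (cong +_ a*c≡)
            (trans (ℤ.pos-* (suc b) (suc d)) (sym (ℤ.*-identityˡ _)))))

[C+1]/[2C]*[mC]/E≡1 : ∀ C E m → 1 ≤ C → 1 ≤ m → 2 * E ≡ m * (C + 1) →
                      frac (C + 1) (2 * C) ℚ.* frac (m * C) E ≡ 1ℚ
[C+1]/[2C]*[mC]/E≡1 (suc c) zero    (suc m) _ _ 2E≡ = ⊥-elim (0≢1+n 2E≡)
[C+1]/[2C]*[mC]/E≡1 (suc c) (suc e) m       _ _ 2E≡ =
  frac*frac≡1 (suc c + 1) (c + suc (c + 0)) (m * suc c) e (begin
    (suc c + 1) * (m * suc c)   ≡⟨ lemma₁ (suc c) m ⟩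
    suc c * (m * (suc c + 1))   ≡⟨ cong (suc c *_) 2E≡ ⟨
    suc c * (2 * suc e)         ≡⟨ lemma₂ (suc c) (suc e) ⟩
    2 * suc c * suc e           ∎)
  where
  open ≡-Reasoning
  lemma₁ : ∀ C m → (C + 1) * (m * C) ≡ C * (m * (C + 1))
  lemma₁ = solve-∀
  lemma₂ : ∀ C E → C * (2 * E) ≡ 2 * C * E
  lemma₂ = solve-∀

m≤n⇒m∣n! : ∀ {m n} → 1 ≤ m → m ≤ n → m ∣ n !
m≤n⇒m∣n! {suc m} _ m≤n = ∣-trans (m∣m*n (m !)) (m≤n⇒m!∣n! m≤n)

module FactorialConstruction (k : ℕ) (1≤k : 1 ≤ k) =
  Construction k (suc k !) {{suc k !≢0}} 1≤k (λ 3≤s → m≤n⇒m∣n! (≤-trans (s≤s z≤n) 3≤s))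

instanceFor : (ℓ : ℕ) → 3 ≤ ℓ → Instance ℓ
instanceFor (suc k) (s≤s 2≤k) = FactorialConstruction.construction k (≤-trans (s≤s z≤n) 2≤k)

quantity≡1 : ∀ ℓ (h : 3 ≤ ℓ) → quantity (instanceFor ℓ h) ≡ 1ℚ
quantity≡1 (suc k) (s≤s 2≤k) =
  [C+1]/[2C]*[mC]/E≡1 (suc k C 2) (numEdges G (proj₁ greedy-run)) (suc k !) 1≤C (1≤n! (suc k))
                      (proj₂ (proj₂ greedy-run))
  where
  1≤k = ≤-trans (s≤s z≤n) 2≤k
  open FactorialConstruction k 1≤k using (G; greedy-run)
  1≤C : 1 ≤ suc k C 2
  1≤C = subst (1 ≤_) (sym (suc-C2 k)) (≤-trans 1≤k (m≤m+n k (k C 2)))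

theorem4 : Σ ((ℓ : ℕ) → 3 ≤ ℓ → Instance ℓ) λ F →
    ∀ (ε : ℚ) → 0ℚ < ε →
      ∃ λ (N : ℕ) → ∀ (ℓ : ℕ) (h : 3 ≤ ℓ) → N ≤ ℓ →
        ∣ quantity (F ℓ h) - 1ℚ ∣ < ε
theorem4 = instanceFor , λ ε 0<ε → 3 , λ ℓ h _ → subst (λ q → ∣ q - 1ℚ ∣ < ε) (sym (quantity≡1 ℓ h)) 0<ε
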